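{- For integers $n,m$ with $\frac{n-1}{2}\le m\le n-1$, $$H(A_{n,m})=\frac{1}{24}\left(3n^2+2mn+m^2-9m+19n-22\right).$$
   Context: The Harary index of a connected graph $G$ is $H(G)=\sum_{\{x,y\}\subseteq V(G),\,x\ne y}\frac{1}{d(x,y)}$, $d$ the shortest-path distance. For $\frac{n-1}{2}\le m\le n-1$, the spur $A_{n,m}$ is the tree obtained from the star $S_{m+1}$ (with $m$ pendent vertices) by adding a pendent edge to each of $n-m-1$ of its pendent vertices; it has $n$ vertices and $m$ pendent vertices. -}

module Defs where

open import Data.Bool using (Bool; true; false; _∧_; _∨_; if_then_else_)
open import Data.Nat using (ℕ; zero; suc; _+_; _*_; _∸_; _≤_; _<_; _≡ᵇ_; _≤ᵇ_; _<ᵇ_)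
open import Data.Fin using (Fin; toℕ)
open import Data.List using (List; foldr; map; allFin)
open import Data.Bool.ListAction using (any)
open import Data.Integer using (ℤ; +_)
import Data.Integer as ℤ
open import Data.Rational using (ℚ; 0ℚ; _/_)
import Data.Rational as ℚ

Graph : ℕ → Set
Graph n = Fin n → Fin n → Bool

reach : ∀ {n} → Graph n → ℕ → Fin n → Fin n → Bool
reach G zero    x y = toℕ x ≡ᵇ toℕ y
reach G (suc k) x y =
  reach G k x y ∨ any (λ z → reach G k x z ∧ G z y) (allFin _)

searchDist : ∀ {n} → Graph n → Fin n → Fin n → ℕ → ℕ → ℕ
searchDist G x y i zero       = i
searchDist G x y i (suc fuel) =
  if reach G i x y then i else searchDist G x y (suc i) fuel

-- shortest-path distance d(x,y): the least k with a walk of length k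
-- (in a connected graph on n vertices, d(x,y) ≤ n - 1 < n).
dist : ∀ {n} → Graph n → Fin n → Fin n → ℕ
dist {n} G x y = searchDist G x y 0 n

-- 1/k as a rational (k ≥ 1 for distinct vertices; 1/0 := 0 is never used)
recip : ℕ → ℚ
recip zero    = 0ℚ
recip (suc k) = + 1 / suc k

sumℚ : List ℚ → ℚ
sumℚ = foldr ℚ._+_ 0ℚ

harary : ∀ {n} → Graph n → ℚ
harary {n} G =
  sumℚ (map (λ x → sumℚ (map (λ y →
            if toℕ x <ᵇ toℕ y then recip (dist G x y) else 0ℚ)
          (allFin n))) (allFin n))

-- The spur A_{n,m} on vertex set {0,…,n-1}:
--   vertex 0 is the centre of the star S_{m+1}, vertices 1,…,m are its
--   pendent vertices, and for 1 ≤ a ≤ n-m-1 the vertex a+m is a new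
--   pendent vertex attached to a.

spurEdge : ℕ → ℕ → ℕ → ℕ → Bool
spurEdge n m a b =
  ((a ≡ᵇ 0) ∧ (1 ≤ᵇ b) ∧ (b ≤ᵇ m))
  ∨ ((1 ≤ᵇ a) ∧ (a ≤ᵇ (n ∸ m ∸ 1)) ∧ (b ≡ᵇ a + m))

spur : (n m : ℕ) → Graph n
spur n m x y = spurEdge n m (toℕ x) (toℕ y) ∨ spurEdge n m (toℕ y) (toℕ x)

module Submission where

-- With k = n - m - 1 ≤ m, the spur A_{n,m} is a spider: the centre has m neighbours (inner
-- vertices), k of which carry one further pendent (outer) vertex.  The distance between two
-- vertices depends only on their positions (centre, inner i, outer j), and this position
-- distance is the graph distance because it vanishes only at the source, grows by at most one
-- along an edge, and drops by exactly one along some edge into every other vertex.  All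
-- distances are at most 4, so H is a sum of twelfths: pairs whose larger vertex is inner i
-- contribute 12 + 6i, pairs whose larger vertex is outer j contribute 14 + 4m + 3j, and
-- summing these with 2 ∑_{i<p} i = p² - p gives the closed form.

open import Defs
open import Data.Nat using (ℕ; _+_; _*_; _≤_; _<_)
open import Data.Integer using (+_)
import Data.Integer as ℤ
open import Data.Rational using (ℚ; _/_)
open import Relation.Binary.PropositionalEquality using (_≡_)

open import Data.Nat using (zero; suc; _∸_; _≤ᵇ_; _<ᵇ_; _≡ᵇ_; z≤n; s≤s; s≤s⁻¹; z<s; s<s)
open import Data.Nat.Properties
open import Data.Nat.ListAction using (sum)
open import Data.Nat.Tactic.RingSolver using (solve-∀)
open import Algebra.Properties.CommutativeSemigroup +-commutativeSemigroup using (interchange)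
open import Data.Bool using (true; false; T; if_then_else_)
open import Data.Bool.Properties using (T-≡; T-∨; T-∧; ∨-identityʳ; if-float)
open import Data.Unit using (⊤)
open import Data.Empty using (⊥-elim)
open import Data.Fin using (Fin; toℕ; fromℕ<)
open import Data.Fin.Properties using (toℕ-injective; toℕ<n; toℕ-fromℕ<; injective⇒≤)
open import Data.List using ([]; _∷_; map; allFin; tabulate)
open import Data.List.Properties using (map-cong; map-tabulate)
open import Data.List.Membership.Propositional using (lose)
open import Data.List.Membership.Propositional.Properties using (∈-allFin)
open import Data.List.Relation.Unary.Any using (satisfied)
open import Data.List.Relation.Unary.Any.Properties using (any⁺; any⁻)
open import Data.Product using (∃-syntax; _×_; _,_; proj₁; proj₂)
open import Data.Sum as Sum using (_⊎_; inj₁; inj₂)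
import Data.Integer.Properties as ℤ
import Data.Integer.Tactic.RingSolver as ℤ-Solver
open import Data.Rational using (0ℚ)
import Data.Rational as ℚ
import Data.Rational.Properties as ℚ
import Data.Rational.Unnormalised as ℚᵘ
import Data.Rational.Unnormalised.Properties as ℚᵘ
open import Function using (_∘_; Equivalence; _⇔_; mk⇔)
open import Function.Definitions using (Injective)
open import Relation.Nullary using (yes; no)
open import Relation.Nullary.Reflects using (Reflects; ofʸ; fromEquivalence)
open import Relation.Binary.PropositionalEquality using (refl; sym; trans; cong; cong₂; subst; subst₂; _≢_)
open Relation.Binary.PropositionalEquality.≡-Reasoning
open Equivalence using (to; from)

∑< : ℕ → (ℕ → ℕ) → ℕ
∑< zero    f = 0
∑< (suc n) f = f 0 + ∑< n (f ∘ suc)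

syntax ∑< n (λ i → e) = ∑[ i < n ] e

∑-cong : ∀ n {f g : ℕ → ℕ} → (∀ i → i < n → f i ≡ g i) → ∑< n f ≡ ∑< n g
∑-cong zero    f≡g = refl
∑-cong (suc n) f≡g = cong₂ _+_ (f≡g 0 z<s) (∑-cong n λ i i<n → f≡g (suc i) (s<s i<n))

∑-const : ∀ n c → ∑[ _ < n ] c ≡ n * c
∑-const zero    c = refl
∑-const (suc n) c = cong (_+_ c) (∑-const n c)

∑-+ : ∀ n (f g : ℕ → ℕ) → ∑[ i < n ] (f i + g i) ≡ ∑< n f + ∑< n g
∑-+ zero    f g = refl
∑-+ (suc n) f g =
  trans (cong (_+_ (f 0 + g 0)) (∑-+ n (f ∘ suc) (g ∘ suc))) (interchange (f 0) (g 0) _ _)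

∑-*ʳ : ∀ n (f : ℕ → ℕ) c → ∑[ i < n ] (f i * c) ≡ ∑< n f * c
∑-*ʳ zero    f c = refl
∑-*ʳ (suc n) f c = trans (cong (_+_ (f 0 * c)) (∑-*ʳ n (f ∘ suc) c)) (sym (*-distribʳ-+ c (f 0) _))

∑-affine : ∀ n c d → ∑[ i < n ] (c + i * d) ≡ n * c + (∑[ i < n ] i) * d
∑-affine n c d = trans (∑-+ n _ _) (cong₂ _+_ (∑-const n c) (∑-*ʳ n (λ i → i) d))

∑-split : ∀ p q (f : ℕ → ℕ) → ∑< (p + q) f ≡ ∑< p f + ∑[ i < q ] f (p + i)
∑-split zero    q f = refl
∑-split (suc p) q f = trans (cong (_+_ (f 0)) (∑-split p q (f ∘ suc))) (sym (+-assoc (f 0) _ _))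

∑-comm : ∀ p q (f : ℕ → ℕ → ℕ) → ∑[ a < p ] ∑< q (f a) ≡ ∑[ b < q ] ∑[ a < p ] f a b
∑-comm zero    q f = sym (trans (∑-const q 0) (*-zeroʳ q))
∑-comm (suc p) q f = begin
  ∑< q (f 0) + ∑[ a < p ] ∑< q (f (suc a))       ≡⟨ cong (_+_ (∑< q (f 0))) (∑-comm p q (f ∘ suc)) ⟩
  ∑< q (f 0) + ∑[ b < q ] ∑[ a < p ] f (suc a) b  ≡⟨ ∑-+ q (f 0) _ ⟨
  ∑[ b < q ] ∑[ a < suc p ] f a b                 ∎

∑-below : ∀ n b (f : ℕ → ℕ) → b ≤ n → ∑[ a < n ] (if a <ᵇ b then f a else 0) ≡ ∑< b f
∑-below n       zero    f _         = trans (∑-const n 0) (*-zeroʳ n)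
∑-below (suc n) (suc b) f (s≤s b≤n) = cong (_+_ (f 0)) (∑-below n b (f ∘ suc) b≤n)

∑-indicator : ∀ n j c → j < n → ∑[ a < n ] (if a ≡ᵇ j then c else 0) ≡ c
∑-indicator (suc n) zero    c _         = trans (cong (_+_ c) (trans (∑-const n 0) (*-zeroʳ n))) (+-identityʳ c)
∑-indicator (suc n) (suc j) c (s≤s j<n) = ∑-indicator n j c j<n

∑-triangular : ∀ n → (∑[ i < n ] i) * 2 + n ≡ n * n
∑-triangular zero    = refl
∑-triangular (suc n) = begin
  (∑[ i < n ] (1 + i)) * 2 + suc n             ≡⟨ cong (λ s → s * 2 + suc n) ∑[1+i]≡n+∑i ⟩
  (n + ∑[ i < n ] i) * 2 + suc n               ≡⟨ shift n (∑[ i < n ] i) ⟩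
  ((∑[ i < n ] i) * 2 + n) + (2 * n + 1)       ≡⟨ cong (_+ (2 * n + 1)) (∑-triangular n) ⟩
  n * n + (2 * n + 1)                           ≡⟨ square n ⟩
  suc n * suc n                                 ∎
  where
  ∑[1+i]≡n+∑i : ∑[ i < n ] (1 + i) ≡ n + ∑[ i < n ] i
  ∑[1+i]≡n+∑i =
    trans (∑-+ n (λ _ → 1) (λ i → i)) (cong (_+ ∑< n (λ i → i)) (trans (∑-const n 1) (*-identityʳ n)))
  shift : ∀ n s → (n + s) * 2 + suc n ≡ (s * 2 + n) + (2 * n + 1)
  shift = solve-∀
  square : ∀ n → n * n + (2 * n + 1) ≡ suc n * suc n
  square = solve-∀

sum-allFin : ∀ n (f : ℕ → ℕ) → sum (map (f ∘ toℕ) (allFin n)) ≡ ∑< n f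
sum-allFin n f = trans (cong sum (map-tabulate {n = n} (λ i → i) (f ∘ toℕ))) (sum-tabulate n f)
  where
  sum-tabulate : ∀ n (f : ℕ → ℕ) → sum (tabulate {n = n} (f ∘ toℕ)) ≡ ∑< n f
  sum-tabulate zero    f = refl
  sum-tabulate (suc n) f = cong (_+_ (f 0)) (sum-tabulate n (f ∘ suc))

/-cross : ∀ (i j : ℤ.ℤ) d e → i ℤ.* + suc e ≡ j ℤ.* + suc d → i / suc d ≡ j / suc e
/-cross i j d e eq = ℚ.fromℚᵘ-cong {ℚᵘ.mkℚᵘ i d} {ℚᵘ.mkℚᵘ j e} (ℚᵘ.*≡* eq)

/-+ : ∀ (i j : ℤ.ℤ) d → i / suc d ℚ.+ j / suc d ≡ (i ℤ.+ j) / suc d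
/-+ i j d = ℚ.toℚᵘ-injective (begin-≃
  ℚ.toℚᵘ (i / suc d ℚ.+ j / suc d)
    ≈⟨ ℚ.toℚᵘ-homo-+ (i / suc d) (j / suc d) ⟩
  ℚ.toℚᵘ (i / suc d) ℚᵘ.+ ℚ.toℚᵘ (j / suc d)
    ≈⟨ ℚᵘ.+-cong (ℚ.toℚᵘ-fromℚᵘ (ℚᵘ.mkℚᵘ i d)) (ℚ.toℚᵘ-fromℚᵘ (ℚᵘ.mkℚᵘ j d)) ⟩
  ℚᵘ.mkℚᵘ i d ℚᵘ.+ ℚᵘ.mkℚᵘ j d
    ≈⟨ ℚᵘ.*≡* (trans (numerator i j (+ suc d)) (cong (ℤ._*_ (i ℤ.+ j)) (sym (ℤ.pos-* (suc d) (suc d))))) ⟩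
  ℚᵘ.mkℚᵘ (i ℤ.+ j) d
    ≈⟨ ℚ.toℚᵘ-fromℚᵘ (ℚᵘ.mkℚᵘ (i ℤ.+ j) d) ⟨
  ℚ.toℚᵘ ((i ℤ.+ j) / suc d)
    ∎≃)
  where
  open ℚᵘ.≃-Reasoning renaming (begin_ to begin-≃_; _∎ to _∎≃)
  numerator : ∀ a b c → (a ℤ.* c ℤ.+ b ℤ.* c) ℤ.* c ≡ (a ℤ.+ b) ℤ.* (c ℤ.* c)
  numerator = ℤ-Solver.solve-∀

sumℚ-/ : ∀ {A : Set} d (f : A → ℕ) xs →
         sumℚ (map (λ z → + f z / suc d) xs) ≡ + sum (map f xs) / suc d
sumℚ-/ d f []       = sym (ℚ.0/n≡0 (suc d))
sumℚ-/ d f (x ∷ xs) = begin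
  + f x / suc d ℚ.+ sumℚ (map (λ z → + f z / suc d) xs)
    ≡⟨ cong (ℚ._+_ (+ f x / suc d)) (sumℚ-/ d f xs) ⟩
  + f x / suc d ℚ.+ + sum (map f xs) / suc d
    ≡⟨ /-+ (+ f x) (+ sum (map f xs)) d ⟩
  (+ f x ℤ.+ + sum (map f xs)) / suc d
    ≡⟨ cong (_/ suc d) (ℤ.pos-+ (f x) (sum (map f xs))) ⟨
  + sum (map f (x ∷ xs)) / suc d
    ∎

record IsDistanceFrom {n} (G : Graph n) (x : Fin n) (δ : Fin n → ℕ) : Set where
  field
    source      : δ x ≡ 0
    zero⇒source : ∀ {y} → δ y ≡ 0 → x ≡ y
    edge        : ∀ {z y} → T (G z y) → δ y ≤ suc (δ z)
    predecessor : ∀ {y t} → δ y ≡ suc t → ∃[ z ] T (G z y) × δ z ≡ t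

module _ {n} {G : Graph n} {x : Fin n} {δ : Fin n → ℕ} (isDistance : IsDistanceFrom G x δ) where
  open IsDistanceFrom isDistance

  reach⇔δ≤ : ∀ t y → T (reach G t x y) ⇔ δ y ≤ t
  reach⇔δ≤ zero y = mk⇔
    (λ x≡y → ≤-reflexive (trans (cong δ (sym (toℕ-injective (≡ᵇ⇒≡ _ _ x≡y)))) source))
    (λ δy≤0 → ≡⇒≡ᵇ _ _ (cong toℕ (zero⇒source (n≤0⇒n≡0 δy≤0))))
  reach⇔δ≤ (suc t) y = mk⇔ reached⇒δ≤ δ≤⇒reached
    where
    reached⇒δ≤ : T (reach G (suc t) x y) → δ y ≤ suc t
    reached⇒δ≤ r with to T-∨ r
    ... | inj₁ r′ = m≤n⇒m≤1+n (to (reach⇔δ≤ t y) r′)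
    ... | inj₂ r′ with z , rz∧e ← satisfied (any⁻ _ (allFin n) r′) with rz , e ← to T-∧ rz∧e =
      ≤-trans (edge e) (s≤s (to (reach⇔δ≤ t z) rz))
    δ≤⇒reached : δ y ≤ suc t → T (reach G (suc t) x y)
    δ≤⇒reached δy≤1+t with m≤n⇒m<n∨m≡n δy≤1+t
    ... | inj₁ δy≤t = from T-∨ (inj₁ (from (reach⇔δ≤ t y) (s≤s⁻¹ δy≤t)))
    ... | inj₂ δy≡1+t with z , e , δz≡t ← predecessor δy≡1+t =
      from T-∨ (inj₂ (any⁺ _ (lose (∈-allFin z)
        (from T-∧ (from (reach⇔δ≤ t z) (≤-reflexive δz≡t) , e)))))

  layer : ∀ {y} d → δ y ≡ d → ∀ s → s ≤ d → ∃[ z ] δ z ≡ s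
  layer {y} d δy≡d s s≤d with m≤n⇒m<n∨m≡n s≤d
  layer {y} d δy≡d s s≤d | inj₂ refl = y , δy≡d
  layer {y} (suc d) δy≡d s s≤d | inj₁ s<d with z , _ , δz≡d ← predecessor δy≡d =
    layer d δz≡d s (s≤s⁻¹ s<d)

  -- Descending along predecessors from y meets every layer 0, …, δ y: δ y + 1 distinct vertices.
  δ<n : ∀ y → δ y < n
  δ<n y = injective⇒≤ layerVertex-injective
    where
    layerVertex : Fin (suc (δ y)) → Fin n
    layerVertex s = proj₁ (layer (δ y) refl (toℕ s) (s≤s⁻¹ (toℕ<n s)))
    δ-layerVertex : ∀ s → δ (layerVertex s) ≡ toℕ s
    δ-layerVertex s = proj₂ (layer (δ y) refl (toℕ s) (s≤s⁻¹ (toℕ<n s)))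
    layerVertex-injective : Injective _≡_ _≡_ layerVertex
    layerVertex-injective {s} {s′} eq =
      toℕ-injective (trans (sym (δ-layerVertex s)) (trans (cong δ eq) (δ-layerVertex s′)))

  searchDist≡δ : ∀ {y} fuel i → i ≤ δ y → δ y ≤ i + fuel → searchDist G x y i fuel ≡ δ y
  searchDist≡δ {y} zero i i≤δ δ≤i = ≤-antisym i≤δ (subst (δ y ≤_) (+-identityʳ i) δ≤i)
  searchDist≡δ {y} (suc fuel) i i≤δ δ≤i with reach G i x y in reached
  ... | true  = ≤-antisym i≤δ (to (reach⇔δ≤ i y) (subst T (sym reached) _))
  ... | false = searchDist≡δ fuel (suc i)
                  (≰⇒> λ δ≤i′ → subst T reached (from (reach⇔δ≤ i y) δ≤i′))
                  (subst (δ y ≤_) (+-suc i fuel) δ≤i)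

  dist≡δ : ∀ y → dist G x y ≡ δ y
  dist≡δ y = searchDist≡δ n 0 z≤n (<⇒≤ (δ<n y))

harary-by-columns : ∀ {n} (G : Graph n) d (w : ℕ → ℕ → ℕ) →
  (∀ x y → toℕ x < toℕ y → recip (dist G x y) ≡ + w (toℕ x) (toℕ y) / suc d) →
  harary G ≡ + (∑[ b < n ] ∑[ a < b ] w a b) / suc d
harary-by-columns {n} G d w recip≡w = begin
  harary G
    ≡⟨ cong sumℚ (map-cong row (allFin n)) ⟩
  sumℚ (map (λ x → + ∑< n (upper (toℕ x)) / suc d) (allFin n))
    ≡⟨ sumℚ-/ d _ (allFin n) ⟩
  + sum (map (λ x → ∑< n (upper (toℕ x))) (allFin n)) / suc d
    ≡⟨ cong (λ s → + s / suc d) (sum-allFin n λ a → ∑< n (upper a)) ⟩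
  + (∑[ a < n ] ∑< n (upper a)) / suc d
    ≡⟨ cong (λ s → + s / suc d) (∑-comm n n upper) ⟩
  + (∑[ b < n ] ∑[ a < n ] upper a b) / suc d
    ≡⟨ cong (λ s → + s / suc d) (∑-cong n λ b b<n → ∑-below n b (λ a → w a b) (<⇒≤ b<n)) ⟩
  + (∑[ b < n ] ∑[ a < b ] w a b) / suc d
    ∎
  where
  upper : ℕ → ℕ → ℕ
  upper a b = if a <ᵇ b then w a b else 0
  entry : ∀ x y → (if toℕ x <ᵇ toℕ y then recip (dist G x y) else 0ℚ)
                ≡ + upper (toℕ x) (toℕ y) / suc d
  entry x y with toℕ x <ᵇ toℕ y | <ᵇ-reflects-< (toℕ x) (toℕ y)
  ... | true  | ofʸ x<y = recip≡w x y x<y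
  ... | false | _       = sym (ℚ.0/n≡0 (suc d))
  row : ∀ x → sumℚ (map (λ y → if toℕ x <ᵇ toℕ y then recip (dist G x y) else 0ℚ) (allFin n))
            ≡ + ∑< n (upper (toℕ x)) / suc d
  row x = begin
    sumℚ (map (λ y → if toℕ x <ᵇ toℕ y then recip (dist G x y) else 0ℚ) (allFin n))
      ≡⟨ cong sumℚ (map-cong (entry x) (allFin n)) ⟩
    sumℚ (map (λ y → + upper (toℕ x) (toℕ y) / suc d) (allFin n))
      ≡⟨ sumℚ-/ d _ (allFin n) ⟩
    + sum (map (λ y → upper (toℕ x) (toℕ y)) (allFin n)) / suc d
      ≡⟨ cong (λ s → + s / suc d) (sum-allFin n (upper (toℕ x))) ⟩
    + ∑< n (upper (toℕ x)) / suc d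
      ∎

twelfths : ℕ → ℕ
twelfths 1 = 12
twelfths 2 = 6
twelfths 3 = 4
twelfths 4 = 3
twelfths _ = 0

recip≡twelfths : ∀ {d} → 1 ≤ d → d ≤ 4 → recip d ≡ + twelfths d / 12
recip≡twelfths {1} _ _ = refl
recip≡twelfths {2} _ _ = refl
recip≡twelfths {3} _ _ = refl
recip≡twelfths {4} _ _ = refl
recip≡twelfths {suc (suc (suc (suc (suc _))))} _ (s≤s (s≤s (s≤s (s≤s ()))))

-- Adding 6m + 3k turns the triangular sums s, t into the squares 2s + m, 2t + k.
numerator-identity : ∀ m k s t → s * 2 + m ≡ m * m → t * 2 + k ≡ k * k →
  ((m * 12 + s * 6) + (k * (14 + m * 4) + t * 3)) * 2 + (9 * m + 22)
    ≡ 3 * suc (m + k) * suc (m + k) + 2 * m * suc (m + k) + m * m + 19 * suc (m + k)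
numerator-identity m k s t 2s+m≡m² 2t+k≡k² = +-cancelʳ-≡ (m * 6 + k * 3) _ _ (begin
  ((m * 12 + s * 6) + (k * (14 + m * 4) + t * 3)) * 2 + (9 * m + 22) + (m * 6 + k * 3)
    ≡⟨ collect m k s t ⟩
  (33 * m + 28 * k + 8 * m * k + 22) + 6 * (s * 2 + m) + 3 * (t * 2 + k)
    ≡⟨ cong₂ (λ u v → (33 * m + 28 * k + 8 * m * k + 22) + 6 * u + 3 * v) 2s+m≡m² 2t+k≡k² ⟩
  (33 * m + 28 * k + 8 * m * k + 22) + 6 * (m * m) + 3 * (k * k)
    ≡⟨ expand m k ⟩
  3 * suc (m + k) * suc (m + k) + 2 * m * suc (m + k) + m * m + 19 * suc (m + k) + (m * 6 + k * 3)
    ∎)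
  where
  collect : ∀ m k s t →
    ((m * 12 + s * 6) + (k * (14 + m * 4) + t * 3)) * 2 + (9 * m + 22) + (m * 6 + k * 3)
      ≡ (33 * m + 28 * k + 8 * m * k + 22) + 6 * (s * 2 + m) + 3 * (t * 2 + k)
  collect = solve-∀
  expand : ∀ m k → (33 * m + 28 * k + 8 * m * k + 22) + 6 * (m * m) + 3 * (k * k)
    ≡ 3 * suc (m + k) * suc (m + k) + 2 * m * suc (m + k) + m * m + 19 * suc (m + k) + (m * 6 + k * 3)
  expand = solve-∀

double-denominator : ∀ s b {a} → s * 2 + b ≡ a → + s / 12 ≡ (+ a ℤ.- + b) / 24
double-denominator s b {a} s*2+b≡a = /-cross (+ s) (+ a ℤ.- + b) 11 23 (begin
  + s ℤ.* + 24                        ≡⟨ halve (+ s) (+ b) ⟩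
  (+ s ℤ.* + 2 ℤ.+ + b ℤ.- + b) ℤ.* + 12 ≡⟨ cong (λ c → (c ℤ.- + b) ℤ.* + 12) +a≡ ⟨
  (+ a ℤ.- + b) ℤ.* + 12              ∎)
  where
  halve : ∀ s b → s ℤ.* + 24 ≡ (s ℤ.* + 2 ℤ.+ b ℤ.- b) ℤ.* + 12
  halve = ℤ-Solver.solve-∀
  +a≡ : + a ≡ + s ℤ.* + 2 ℤ.+ + b
  +a≡ = trans (cong +_ (sym s*2+b≡a)) (trans (ℤ.pos-+ (s * 2) b) (cong (ℤ._+ + b) (ℤ.pos-* s 2)))

data Position : Set where
  centre : Position
  inner  : ℕ → Position
  outer  : ℕ → Position

data Edge : Position → Position → Set where
  spoke : ∀ i → Edge centre (inner i)
  hang  : ∀ j → Edge (inner j) (outer j)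

Adjacent : Position → Position → Set
Adjacent p q = Edge p q ⊎ Edge q p

posDist : Position → Position → ℕ
posDist centre    centre     = 0
posDist centre    (inner _)  = 1
posDist centre    (outer _)  = 2
posDist (inner _) centre     = 1
posDist (inner i) (inner i′) = if i ≡ᵇ i′ then 0 else 2
posDist (inner i) (outer j)  = if i ≡ᵇ j then 1 else 3
posDist (outer _) centre     = 2
posDist (outer j) (inner i)  = if j ≡ᵇ i then 1 else 3
posDist (outer j) (outer j′) = if j ≡ᵇ j′ then 0 else 4

≡ᵇ-reflects : ∀ a b → Reflects (a ≡ b) (a ≡ᵇ b)
≡ᵇ-reflects a b = fromEquivalence (≡ᵇ⇒≡ a b) (≡⇒≡ᵇ a b)

≡ᵇ-refl : ∀ a → (a ≡ᵇ a) ≡ true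
≡ᵇ-refl a = to T-≡ (≡⇒≡ᵇ a a refl)

≢⇒≡ᵇ≡false : ∀ {a b} → a ≢ b → (a ≡ᵇ b) ≡ false
≢⇒≡ᵇ≡false {a} {b} a≢b with a ≡ᵇ b | ≡ᵇ-reflects a b
... | true  | ofʸ a≡b = ⊥-elim (a≢b a≡b)
... | false | _       = refl

≤-eval : ∀ {a b} {_ : T (a ≤ᵇ b)} → a ≤ b
≤-eval {a} {b} {a≤ᵇb} = ≤ᵇ⇒≤ a b a≤ᵇb

if-≤ : ∀ b {x y c} → x ≤ c → y ≤ c → (if b then x else y) ≤ c
if-≤ true  x≤c _   = x≤c
if-≤ false _   y≤c = y≤c

posDist-refl : ∀ p → posDist p p ≡ 0
posDist-refl centre    = refl
posDist-refl (inner i) rewrite ≡ᵇ-refl i = refl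
posDist-refl (outer j) rewrite ≡ᵇ-refl j = refl

posDist≡0⇒≡ : ∀ p q → posDist p q ≡ 0 → p ≡ q
posDist≡0⇒≡ centre    centre    _ = refl
posDist≡0⇒≡ centre    (inner _) ()
posDist≡0⇒≡ centre    (outer _) ()
posDist≡0⇒≡ (inner _) centre    ()
posDist≡0⇒≡ (inner i) (inner i′) d≡0 with i ≡ᵇ i′ | ≡ᵇ-reflects i i′
... | true | ofʸ refl = refl
posDist≡0⇒≡ (inner i) (outer j) d≡0 with i ≡ᵇ j
posDist≡0⇒≡ (inner i) (outer j) () | true
posDist≡0⇒≡ (inner i) (outer j) () | false
posDist≡0⇒≡ (outer _) centre    ()
posDist≡0⇒≡ (outer j) (inner i) d≡0 with j ≡ᵇ i
posDist≡0⇒≡ (outer j) (inner i) () | true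
posDist≡0⇒≡ (outer j) (inner i) () | false
posDist≡0⇒≡ (outer j) (outer j′) d≡0 with j ≡ᵇ j′ | ≡ᵇ-reflects j j′
... | true | ofʸ refl = refl

posDist≤4 : ∀ p q → posDist p q ≤ 4
posDist≤4 centre    centre     = ≤-eval
posDist≤4 centre    (inner _)  = ≤-eval
posDist≤4 centre    (outer _)  = ≤-eval
posDist≤4 (inner _) centre     = ≤-eval
posDist≤4 (inner i) (inner i′) = if-≤ (i ≡ᵇ i′) ≤-eval ≤-eval
posDist≤4 (inner i) (outer j)  = if-≤ (i ≡ᵇ j) ≤-eval ≤-eval
posDist≤4 (outer _) centre     = ≤-eval
posDist≤4 (outer j) (inner i)  = if-≤ (j ≡ᵇ i) ≤-eval ≤-eval
posDist≤4 (outer j) (outer j′) = if-≤ (j ≡ᵇ j′) ≤-eval ≤-eval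

posDist-edge : ∀ r {p q} → Edge p q →
  posDist r q ≤ suc (posDist r p) × posDist r p ≤ suc (posDist r q)
posDist-edge centre     (spoke i) = ≤-eval , ≤-eval
posDist-edge centre     (hang j)  = ≤-eval , ≤-eval
posDist-edge (inner i′) (spoke i) with i′ ≡ᵇ i
... | true  = ≤-eval , ≤-eval
... | false = ≤-eval , ≤-eval
posDist-edge (inner i′) (hang j)  with i′ ≡ᵇ j
... | true  = ≤-eval , ≤-eval
... | false = ≤-eval , ≤-eval
posDist-edge (outer j′) (spoke i) with j′ ≡ᵇ i
... | true  = ≤-eval , ≤-eval
... | false = ≤-eval , ≤-eval
posDist-edge (outer j′) (hang j)  with j′ ≡ᵇ j
... | true  = ≤-eval , ≤-eval
... | false = ≤-eval , ≤-eval

posDist-adjacent : ∀ r {p q} → Adjacent p q → posDist r q ≤ suc (posDist r p)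
posDist-adjacent r (inj₁ e) = proj₁ (posDist-edge r e)
posDist-adjacent r (inj₂ e) = proj₂ (posDist-edge r e)

closed-form : ℕ → ℕ → ℚ
closed-form n m = ((+ (3 * n * n + 2 * m * n + m * m + 19 * n)) ℤ.- (+ (9 * m + 22))) / 24

module Spur (m k : ℕ) (k≤m : k ≤ m) where

  n : ℕ
  n = suc (m + k)

  Valid : Position → Set
  Valid centre    = ⊤
  Valid (inner i) = i < m
  Valid (outer j) = j < k

  outer⇒inner-valid : ∀ {j} → Valid (outer j) → Valid (inner j)
  outer⇒inner-valid j<k = ≤-trans j<k k≤m

  label : Position → ℕ
  label centre    = 0
  label (inner i) = suc i
  label (outer j) = suc (m + j)

  position : ℕ → Position
  position zero    = centre
  position (suc a) = if a <ᵇ m then inner a else outer (a ∸ m)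

  position-label : ∀ p → Valid p → position (label p) ≡ p
  position-label centre    _   = refl
  position-label (inner i) i<m rewrite to T-≡ (<⇒<ᵇ i<m) = refl
  position-label (outer j) _   with m + j <ᵇ m | <ᵇ-reflects-< (m + j) m
  ... | true  | ofʸ m+j<m = ⊥-elim (m+n≮m m j m+j<m)
  ... | false | _         = cong outer (m+n∸m≡n m j)

  label-onto : ∀ a → a < n → ∃[ p ] Valid p × label p ≡ a
  label-onto zero    _             = centre , _ , refl
  label-onto (suc a) (s≤s a<m+k) with a <? m
  ... | yes a<m = inner a , a<m , refl
  ... | no  a≮m =
    outer (a ∸ m) , +-cancelˡ-< m _ _ (subst (_< m + k) (sym m+[a∸m]≡a) a<m+k) , cong suc m+[a∸m]≡a
    where
    m+[a∸m]≡a : m + (a ∸ m) ≡ a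
    m+[a∸m]≡a = m+[n∸m]≡n (≮⇒≥ a≮m)

  label<n : ∀ p → Valid p → label p < n
  label<n centre    _   = s≤s z≤n
  label<n (inner i) i<m = s≤s (≤-trans i<m (m≤m+n m k))
  label<n (outer j) j<k = s≤s (+-monoʳ-< m j<k)

  pos : Fin n → Position
  pos y = position (toℕ y)

  pos-valid×label : ∀ y → Valid (pos y) × label (pos y) ≡ toℕ y
  pos-valid×label y with p , valid , label≡ ← label-onto (toℕ y) (toℕ<n y)
    rewrite sym label≡ | position-label p valid = valid , refl

  pos-valid : ∀ y → Valid (pos y)
  pos-valid = proj₁ ∘ pos-valid×label

  label-pos : ∀ y → label (pos y) ≡ toℕ y
  label-pos = proj₂ ∘ pos-valid×label

  pos-injective : ∀ {x y} → pos x ≡ pos y → x ≡ y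
  pos-injective {x} {y} eq = toℕ-injective (begin
    toℕ x         ≡⟨ label-pos x ⟨
    label (pos x) ≡⟨ cong label eq ⟩
    label (pos y) ≡⟨ label-pos y ⟩
    toℕ y         ∎)

  vertex : ∀ p → Valid p → Fin n
  vertex p valid = fromℕ< (label<n p valid)

  pos-vertex : ∀ p valid → pos (vertex p valid) ≡ p
  pos-vertex p valid = trans (cong position (toℕ-fromℕ< (label<n p valid))) (position-label p valid)

  n∸m∸1≡k : n ∸ m ∸ 1 ≡ k
  n∸m∸1≡k = cong (_∸ 1) (trans (cong (_∸ m) (sym (+-suc m k))) (m+n∸m≡n m (suc k)))

  hang-bounds : ∀ {j b} → T (spurEdge n m (suc j) b) → j < k × b ≡ suc (m + j)
  hang-bounds {j} {b} e with 1+j≤ , b≡ ← to T-∧ e =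
    subst (suc j ≤_) n∸m∸1≡k (≤ᵇ⇒≤ _ _ 1+j≤) , trans (≡ᵇ⇒≡ b _ b≡) (cong suc (+-comm j m))

  spurEdge⇒Edge : ∀ a b → T (spurEdge n m a b) → Edge (position a) (position b)
  spurEdge⇒Edge zero    (suc i) e
    rewrite position-label (inner i) (≤ᵇ⇒≤ (suc i) m (subst T (∨-identityʳ _) e)) = spoke i
  spurEdge⇒Edge (suc j) b       e with j<k , refl ← hang-bounds {j} {b} e
    rewrite position-label (inner j) (outer⇒inner-valid j<k) | position-label (outer j) j<k = hang j

  Edge⇒spurEdge : ∀ {p q} → Valid q → Edge p q → T (spurEdge n m (label p) (label q))
  Edge⇒spurEdge i<m (spoke i) = from T-∨ (inj₁ (≤⇒≤ᵇ i<m))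
  Edge⇒spurEdge j<k (hang j)  = from T-∧
    (subst (λ c → T (suc j ≤ᵇ c)) (sym n∸m∸1≡k) (≤⇒≤ᵇ j<k) , ≡⇒≡ᵇ _ _ (cong suc (+-comm m j)))

  spur⇔Adjacent : ∀ z y → T (spur n m z y) ⇔ Adjacent (pos z) (pos y)
  spur⇔Adjacent z y = mk⇔
    (Sum.map (spurEdge⇒Edge (toℕ z) (toℕ y)) (spurEdge⇒Edge (toℕ y) (toℕ z)) ∘ to T-∨)
    (from T-∨ ∘ Sum.map (encode z y) (encode y z))
    where
    encode : ∀ z y → Edge (pos z) (pos y) → T (spurEdge n m (toℕ z) (toℕ y))
    encode z y e = subst₂ (λ a b → T (spurEdge n m a b)) (label-pos z) (label-pos y)
                     (Edge⇒spurEdge (pos-valid y) e)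

  posDist-predecessor : ∀ {r q} → Valid r → Valid q → posDist r q ≢ 0 →
    ∃[ q′ ] Valid q′ × Adjacent q′ q × suc (posDist r q′) ≡ posDist r q
  posDist-predecessor {centre}  {centre}    _   _    d≢0 = ⊥-elim (d≢0 refl)
  posDist-predecessor {centre}  {inner i}   _   _    _   = centre , _ , inj₁ (spoke i) , refl
  posDist-predecessor {centre}  {outer j}   _   j<k  _   =
    inner j , outer⇒inner-valid j<k , inj₁ (hang j) , refl
  posDist-predecessor {inner i} {centre}    i<m _    _   =
    inner i , i<m , inj₂ (spoke i) , cong suc (posDist-refl (inner i))
  posDist-predecessor {inner i} {inner i′}  _   _    d≢0 with i ≡ᵇ i′
  ... | true  = ⊥-elim (d≢0 refl)
  ... | false = centre , _ , inj₁ (spoke i′) , refl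
  posDist-predecessor {inner i} {outer j}   _   j<k  _   =
    inner j , outer⇒inner-valid j<k , inj₁ (hang j) , if-float suc (i ≡ᵇ j)
  posDist-predecessor {outer j} {centre}    j<k _    _   =
    inner j , outer⇒inner-valid j<k , inj₂ (spoke j) , cong (λ b → suc (if b then 1 else 3)) (≡ᵇ-refl j)
  posDist-predecessor {outer j} {inner i}   j<k _    _   with j ≡ᵇ i | ≡ᵇ-reflects j i
  ... | true  | ofʸ refl = outer j , j<k , inj₂ (hang j) , cong suc (posDist-refl (outer j))
  ... | false | _        = centre , _ , inj₁ (spoke i) , refl
  posDist-predecessor {outer j} {outer j′}  _   j′<k d≢0 with j ≡ᵇ j′ in j≡ᵇj′
  ... | true  = ⊥-elim (d≢0 refl)
  ... | false = inner j′ , outer⇒inner-valid j′<k , inj₁ (hang j′) ,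
                cong (λ b → suc (if b then 1 else 3)) j≡ᵇj′

  spurDist : ℕ → ℕ → ℕ
  spurDist a b = posDist (position a) (position b)

  spur-isDistanceFrom : ∀ x → IsDistanceFrom (spur n m) x (λ y → spurDist (toℕ x) (toℕ y))
  spur-isDistanceFrom x = record
    { source      = posDist-refl (pos x)
    ; zero⇒source = λ {y} → pos-injective ∘ posDist≡0⇒≡ (pos x) (pos y)
    ; edge        = λ {z} {y} e → posDist-adjacent (pos x) (to (spur⇔Adjacent z y) e)
    ; predecessor = λ {y} → predecessor {y}
    }
    where
    predecessor : ∀ {y t} → spurDist (toℕ x) (toℕ y) ≡ suc t →
                  ∃[ z ] T (spur n m z y) × spurDist (toℕ x) (toℕ z) ≡ t
    predecessor {y} d≡1+t
      with q , valid , q~y , step ← posDist-predecessor (pos-valid x) (pos-valid y)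
                                       (λ d≡0 → 0≢1+n (trans (sym d≡0) d≡1+t))
      = vertex q valid
      , from (spur⇔Adjacent (vertex q valid) y)
             (subst (λ p → Adjacent p (pos y)) (sym (pos-vertex q valid)) q~y)
      , suc-injective (trans (cong (suc ∘ posDist (pos x)) (pos-vertex q valid)) (trans step d≡1+t))

  weight : ℕ → ℕ → ℕ
  weight a b = twelfths (spurDist a b)

  recip-dist : ∀ x y → toℕ x < toℕ y → recip (dist (spur n m) x y) ≡ + weight (toℕ x) (toℕ y) / 12
  recip-dist x y x<y rewrite dist≡δ (spur-isDistanceFrom x) y =
    recip≡twelfths (n≢0⇒n>0 (<⇒≢ x<y ∘ cong toℕ ∘ zero⇒source)) (posDist≤4 (pos x) (pos y))
    where open IsDistanceFrom (spur-isDistanceFrom x)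

  column-inner : ∀ {i} → i < m → ∑[ a < suc i ] weight a (suc i) ≡ 12 + i * 6
  column-inner {i} i<m = cong₂ _+_ centre-weight (trans (∑-cong i inner-weight) (∑-const i 6))
    where
    centre-weight : weight 0 (suc i) ≡ 12
    centre-weight rewrite position-label (inner i) i<m = refl
    inner-weight : ∀ a → a < i → weight (suc a) (suc i) ≡ 6
    inner-weight a a<i rewrite position-label (inner a) (<-trans a<i i<m) | position-label (inner i) i<m
                             | ≢⇒≡ᵇ≡false (<⇒≢ a<i) = refl

  column-outer : ∀ {j} → j < k → ∑[ a < suc (m + j) ] weight a (suc (m + j)) ≡ (14 + m * 4) + j * 3
  column-outer {j} j<k = begin
    weight 0 (suc (m + j)) + ∑[ a < m + j ] weight (suc a) (suc (m + j))
      ≡⟨ cong₂ _+_ centre-weight (∑-split m j λ a → weight (suc a) (suc (m + j))) ⟩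
    6 + (∑[ a < m ] weight (suc a) (suc (m + j)) + ∑[ t < j ] weight (suc (m + t)) (suc (m + j)))
      ≡⟨ cong (_+_ 6) (cong₂ _+_ inner-part (trans (∑-cong j outer-weight) (∑-const j 3))) ⟩
    6 + (m * 4 + 8 + j * 3)
      ≡⟨ regroup m j ⟩
    (14 + m * 4) + j * 3
      ∎
    where
    regroup : ∀ m j → 6 + (m * 4 + 8 + j * 3) ≡ (14 + m * 4) + j * 3
    regroup = solve-∀
    centre-weight : weight 0 (suc (m + j)) ≡ 6
    centre-weight rewrite position-label (outer j) j<k = refl
    inner-weight : ∀ a → a < m → weight (suc a) (suc (m + j)) ≡ 4 + (if a ≡ᵇ j then 8 else 0)
    inner-weight a a<m rewrite position-label (inner a) a<m | position-label (outer j) j<k with a ≡ᵇ j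
    ... | true  = refl
    ... | false = refl
    inner-part : ∑[ a < m ] weight (suc a) (suc (m + j)) ≡ m * 4 + 8
    inner-part = begin
      ∑[ a < m ] weight (suc a) (suc (m + j))
        ≡⟨ ∑-cong m inner-weight ⟩
      ∑[ a < m ] (4 + (if a ≡ᵇ j then 8 else 0))
        ≡⟨ ∑-+ m (λ _ → 4) (λ a → if a ≡ᵇ j then 8 else 0) ⟩
      ∑[ _ < m ] 4 + ∑[ a < m ] (if a ≡ᵇ j then 8 else 0)
        ≡⟨ cong₂ _+_ (∑-const m 4) (∑-indicator m j 8 (outer⇒inner-valid j<k)) ⟩
      m * 4 + 8
        ∎
    outer-weight : ∀ t → t < j → weight (suc (m + t)) (suc (m + j)) ≡ 3
    outer-weight t t<j rewrite position-label (outer t) (<-trans t<j j<k) | position-label (outer j) j<k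
                             | ≢⇒≡ᵇ≡false (<⇒≢ t<j) = refl

  weight-total : ∑[ b < n ] ∑[ a < b ] weight a b
               ≡ (m * 12 + (∑[ i < m ] i) * 6) + (k * (14 + m * 4) + (∑[ j < k ] j) * 3)
  weight-total = begin
    ∑[ b < m + k ] column (suc b)
      ≡⟨ ∑-split m k (column ∘ suc) ⟩
    ∑[ i < m ] column (suc i) + ∑[ j < k ] column (suc (m + j))
      ≡⟨ cong₂ _+_ (trans (∑-cong m λ _ → column-inner) (∑-affine m 12 6))
                   (trans (∑-cong k λ _ → column-outer) (∑-affine k (14 + m * 4) 3)) ⟩
    (m * 12 + (∑[ i < m ] i) * 6) + (k * (14 + m * 4) + (∑[ j < k ] j) * 3)
      ∎
    where
    column : ℕ → ℕ
    column b = ∑[ a < b ] weight a b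

  harary-spur : harary (spur n m) ≡ closed-form n m
  harary-spur = begin
    harary (spur n m)
      ≡⟨ harary-by-columns (spur n m) 11 weight recip-dist ⟩
    + (∑[ b < n ] ∑[ a < b ] weight a b) / 12
      ≡⟨ cong (λ s → + s / 12) weight-total ⟩
    + total / 12
      ≡⟨ double-denominator total (9 * m + 22)
           (numerator-identity m k (∑[ i < m ] i) (∑[ j < k ] j) (∑-triangular m) (∑-triangular k)) ⟩
    closed-form n m
      ∎
    where
    total : ℕ
    total = (m * 12 + (∑[ i < m ] i) * 6) + (k * (14 + m * 4) + (∑[ j < k ] j) * 3)

lemma3p3 : (n m : ℕ) → n ≤ 2 * m + 1 → m < n →
    harary (spur n m)
      ≡ (((+ (3 * n * n + 2 * m * n + m * m + 19 * n)) ℤ.- (+ (9 * m + 22))) / 24)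
lemma3p3 n m n≤2m+1 m<n =
  subst (λ n → harary (spur n m) ≡ closed-form n m) 1+m+k≡n (Spur.harary-spur m k k≤m)
  where
  k : ℕ
  k = n ∸ suc m
  1+m+k≡n : suc (m + k) ≡ n
  1+m+k≡n = m+[n∸m]≡n m<n
  2m+1≡1+m+m : ∀ m → 2 * m + 1 ≡ suc m + m
  2m+1≡1+m+m = solve-∀
  k≤m : k ≤ m
  k≤m = +-cancelˡ-≤ (suc m) k m (subst₂ _≤_ (sym 1+m+k≡n) (2m+1≡1+m+m m) n≤2m+1)
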